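{- For any positive even integer $d$, $\chi(P_3^d,d)\ge \log_2(d+8)-2$.
   Context: $P_3^d$ is the tree obtained from a path $v_0,v_1,\ldots,v_d$ with $d$ edges by adding, for each $1\le i\le d$, a new path with $i$ edges having $v_i$ as one endpoint (all other vertices of these added paths are new and distinct). For a graph $G$ and a positive integer $d$, $\chi(G,d)$ denotes the minimum number of colors in a vertex coloring of $G$ such that any two vertices at distance exactly $d$ in $G$ (graph distance) receive distinct colors. -}

module Defs where

open import Data.Nat using (ℕ; zero; suc; _≤_; _<_)
open import Data.Fin using (Fin)
open import Data.Product using (_×_)
open import Data.Sum using (_⊎_)
open import Relation.Binary.PropositionalEquality using (_≡_; _≢_)
open import Relation.Nullary using (¬_)

-- The vertex with coordinates (i , 0) is the spine
-- vertex v_i (0 ≤ i ≤ d); for 1 ≤ j ≤ i, (i , j) is the vertex at distance j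
-- from v_i along the path of i edges attached at v_i.
record Vertex (d : ℕ) : Set where
  constructor vtx
  field
    i   : ℕ
    j   : ℕ
    i≤d : i ≤ d
    j≤i : j ≤ i

open Vertex public

Edge : {d : ℕ} → Vertex d → Vertex d → Set
Edge u v =
  (j u ≡ 0 × j v ≡ 0 × suc (i u) ≡ i v)
  ⊎ (i u ≡ i v × suc (j u) ≡ j v)

Adj : {d : ℕ} → Vertex d → Vertex d → Set
Adj u v = Edge u v ⊎ Edge v u

data Walk {d : ℕ} : Vertex d → Vertex d → ℕ → Set where
  here : ∀ {u} → Walk u u 0
  step : ∀ {u w v n} → Adj u w → Walk w v n → Walk u v (suc n)

DistEq : {d : ℕ} → Vertex d → Vertex d → ℕ → Set
DistEq u v n = Walk u v n × (∀ m → m < n → ¬ Walk u v m)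

IsDistColoring : (d k : ℕ) → (Vertex d → Fin k) → Set
IsDistColoring d k c = ∀ u v → DistEq u v d → c u ≢ c v

-- Write d = 2h with h ≥ 2 and let n = ⌈h/2⌉ + 1.  Place each pair x < y ≤ n at the
-- vertex with spine index x + y + h − 2 and depth x + h − y.  For x < y < z the
-- pairs (x, y) and (y, z) lie on different legs, at distance
-- (x + h − y) + (z − x) + (y + h − z) = 2h = d, so a colouring separating vertices
-- at distance d colours the shift graph on {0, …, n} properly.  There the colour
-- sets S y = {c(x, y) | x < y} are pairwise distinct, since c(y, z) ∈ S z ∖ S y;
-- hence n + 1 ≤ 2^k, and 2h + 8 ≤ 4(n + 1) ≤ 2^(k+2).
module Submission where

open import Defs
open import Data.Nat using (ℕ; zero; suc; _+_; _*_; _∸_; _^_; _≤_; _<_; _≤?_; _≟_; ∣_-_∣; z≤n; s≤s; s≤s⁻¹)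
open import Data.Nat.Properties
open import Data.Nat.Divisibility using (_∣_; divides)
open import Data.Nat.Tactic.RingSolver using (solve-∀)
open import Data.Fin as Fin using (Fin; Fin′; toℕ; fromℕ<; funToFin; finToFun)
open import Data.Fin.Patterns using (0F; 1F)
open import Data.Fin.Properties using (toℕ<n; toℕ≤pred[n]; toℕ-fromℕ<; pigeonhole; any?; finToFun-funToFin)
open import Data.Product using (Σ-syntax; ∃-syntax; _×_; _,_; proj₁; proj₂)
open import Data.Sum using (inj₁; inj₂)
open import Relation.Nullary using (yes; no; contradiction)
open import Relation.Binary.PropositionalEquality

∣n-1+n∣≡1 : ∀ n → ∣ n - suc n ∣ ≡ 1
∣n-1+n∣≡1 zero    = refl
∣n-1+n∣≡1 (suc n) = ∣n-1+n∣≡1 n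

∣1+n-n∣≡1 : ∀ n → ∣ suc n - n ∣ ≡ 1
∣1+n-n∣≡1 n = trans (∣-∣-comm (suc n) n) (∣n-1+n∣≡1 n)

∣1+m-n∣≤1+∣m-n∣ : ∀ m n → ∣ suc m - n ∣ ≤ suc ∣ m - n ∣
∣1+m-n∣≤1+∣m-n∣ zero    zero    = ≤-refl
∣1+m-n∣≤1+∣m-n∣ (suc m) zero    = ≤-refl
∣1+m-n∣≤1+∣m-n∣ zero    (suc n) = m≤n+m n 2
∣1+m-n∣≤1+∣m-n∣ (suc m) (suc n) = ∣1+m-n∣≤1+∣m-n∣ m n

∣m-n∣≤1+∣1+m-n∣ : ∀ m n → ∣ m - n ∣ ≤ suc ∣ suc m - n ∣
∣m-n∣≤1+∣1+m-n∣ zero    zero    = z≤n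
∣m-n∣≤1+∣1+m-n∣ (suc m) zero    = m≤n+m (suc m) 2
∣m-n∣≤1+∣1+m-n∣ zero    (suc n) = ≤-refl
∣m-n∣≤1+∣1+m-n∣ (suc m) (suc n) = ∣m-n∣≤1+∣1+m-n∣ m n

module _ {d : ℕ} where

  Adj-sym : {u v : Vertex d} → Adj u v → Adj v u
  Adj-sym (inj₁ e) = inj₂ e
  Adj-sym (inj₂ e) = inj₁ e

  _▷_ : ∀ {u w v : Vertex d} {m} → Walk u w m → Adj w v → Walk u v (suc m)
  here      ▷ a = step a here
  step b ws ▷ a = step b (ws ▷ a)

  reverse : ∀ {u v : Vertex d} {m} → Walk u v m → Walk v u m
  reverse here                 = here
  reverse (step {u} {w} a ws) = reverse ws ▷ Adj-sym {u} {w} a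

  _++_ : ∀ {u w v : Vertex d} {m n} → Walk u w m → Walk w v n → Walk u v (m + n)
  here      ++ ws′ = ws′
  step a ws ++ ws′ = step a (ws ++ ws′)

  toSpine : ∀ {i j} (p : i ≤ d) (q : j ≤ i) → Walk (vtx i j p q) (vtx i 0 p z≤n) j
  toSpine {j = zero}  p z≤n = here
  toSpine {j = suc j} p q   = step (inj₂ (inj₂ (refl , refl))) (toSpine p (≤-trans (n≤1+n j) q))

  alongSpine : ∀ e {i} (p : i ≤ d) (p′ : e + i ≤ d) →
               Walk (vtx i 0 p z≤n) (vtx (e + i) 0 p′ z≤n) e
  alongSpine zero    p p′ rewrite ≤-irrelevant p p′ = here
  alongSpine (suc e) p p′ =
    alongSpine e p (≤-trans (n≤1+n _) p′) ▷ inj₁ (inj₁ (refl , refl , refl))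

  dist : Vertex d → Vertex d → ℕ
  dist (vtx i j _ _) (vtx i′ j′ _ _) with i ≟ i′
  ... | yes _ = ∣ j - j′ ∣
  ... | no  _ = j + ∣ i - i′ ∣ + j′

  dist-self : ∀ v → dist v v ≡ 0
  dist-self (vtx i j _ _) with i ≟ i
  ... | yes _  = ∣n-n∣≡0 j
  ... | no i≢i = contradiction refl i≢i

  dist-edge : ∀ {u w : Vertex d} v → Edge u w →
              dist u v ≤ suc (dist w v) × dist w v ≤ suc (dist u v)
  dist-edge {vtx i _ _ _} {vtx _ _ _ _} (vtx i′ j′ _ _) (inj₁ (refl , refl , refl))
    with i ≟ i′ | suc i ≟ i′
  ... | yes refl | yes 1+i≡i = contradiction 1+i≡i 1+n≢n
  ... | yes refl | no  _     = ≤-trans (m≤n+m j′ _) (n≤1+n _) , ≤-reflexive (cong (_+ j′) (∣1+n-n∣≡1 i))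
  ... | no  _    | yes refl  = ≤-reflexive (cong (_+ j′) (∣n-1+n∣≡1 i)) , ≤-trans (m≤n+m j′ _) (n≤1+n _)
  ... | no  _    | no  _     = +-monoˡ-≤ j′ (∣m-n∣≤1+∣1+m-n∣ i i′) , +-monoˡ-≤ j′ (∣1+m-n∣≤1+∣m-n∣ i i′)
  dist-edge {vtx i j _ _} {vtx _ _ _ _} (vtx i′ j′ _ _) (inj₂ (refl , refl)) with i ≟ i′
  ... | yes _ = ∣m-n∣≤1+∣1+m-n∣ j j′ , ∣1+m-n∣≤1+∣m-n∣ j j′
  ... | no  _ = m≤n+m _ 2 , ≤-refl

  dist-adj : ∀ {u w : Vertex d} v → Adj u w → dist u v ≤ suc (dist w v)
  dist-adj {u} {w} v (inj₁ e) = proj₁ (dist-edge {u} {w} v e)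
  dist-adj {u} {w} v (inj₂ e) = proj₂ (dist-edge {w} {u} v e)

  dist≤length : ∀ {u v : Vertex d} {m} → Walk u v m → dist u v ≤ m
  dist≤length {v = v} here = ≤-reflexive (dist-self v)
  dist≤length {u} {v} (step {w = w} a ws) = ≤-trans (dist-adj {u} {w} v a) (s≤s (dist≤length ws))

  dist-across : ∀ e (u v : Vertex d) → suc e + i u ≡ i v → dist u v ≡ j u + suc e + j v
  dist-across e (vtx i j _ _) (vtx _ j′ _ _) refl with i ≟ suc e + i
  ... | yes i≡1+e+i = contradiction i≡1+e+i (m≢1+n+m i)
  ... | no  _       = cong (λ gap → j + gap + j′)
                        (trans (cong ∣ i -_∣ (+-comm (suc e) i)) (∣m-m+n∣≡n i (suc e)))

  distEq-across : ∀ e (u v : Vertex d) → suc e + i u ≡ i v → j u + suc e + j v ≡ d → DistEq u v d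
  distEq-across e u@(vtx _ _ p q) v@(vtx _ _ p′ q′) refl length≡d =
    subst (Walk u v) length≡d ((toSpine p q ++ alongSpine (suc e) p p′) ++ reverse (toSpine p′ q′)) ,
    λ m m<d ws → <⇒≱ m<d (subst (_≤ m) (trans (dist-across e u v refl) length≡d) (dist≤length ws))

funToFin-injective : ∀ {m n} {f g : Fin m → Fin n} → funToFin f ≡ funToFin g → ∀ x → f x ≡ g x
funToFin-injective {f = f} {g} f≡g x = begin
  f x                       ≡⟨ finToFun-funToFin f x ⟨
  finToFun (funToFin f) x   ≡⟨ cong (λ code → finToFun code x) f≡g ⟩
  finToFun (funToFin g) x   ≡⟨ finToFun-funToFin g x ⟩
  g x                       ∎
  where open ≡-Reasoning

inImage : ∀ {m k} → (Fin m → Fin k) → Fin k → Fin 2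
inImage f col with any? (λ x → f x Fin.≟ col)
... | yes _ = 1F
... | no  _ = 0F

inImage-yes : ∀ {m k} (f : Fin m → Fin k) x → inImage f (f x) ≡ 1F
inImage-yes f x with any? (λ x′ → f x′ Fin.≟ f x)
... | yes _ = refl
... | no  ∄ = contradiction (x , refl) ∄

inImage-no : ∀ {m k} (f : Fin m → Fin k) col → (∀ x → f x ≢ col) → inImage f col ≡ 0F
inImage-no f col ∉ with any? (λ x → f x Fin.≟ col)
... | yes (x , fx≡col) = contradiction fx≡col (∉ x)
... | no  _            = refl

-- The pair x < y of the shift graph on {0, …, n} is encoded as y together with x : Fin′ y.
IsShiftColouring : ∀ n k → ((y : Fin (suc n)) → Fin′ y → Fin k) → Set
IsShiftColouring n k c = ∀ {y z} (y<z : y Fin.< z) (x : Fin′ y) → c y x ≢ c z (fromℕ< y<z)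

shiftColouring⇒1+n≤2^k : ∀ {n k} (c : (y : Fin (suc n)) → Fin′ y → Fin k) →
                          IsShiftColouring n k c → suc n ≤ 2 ^ k
shiftColouring⇒1+n≤2^k {n} {k} c proper with suc n ≤? 2 ^ k
... | yes fits = fits
... | no ¬fits with pigeonhole (≰⇒> ¬fits) (λ y → funToFin (inImage (c y)))
... | y , z , y<z , sameImage = contradiction (trans (sym absent) (trans agree present)) λ ()
  where
    col = c z (fromℕ< y<z)
    present : inImage (c z) col ≡ 1F
    present = inImage-yes (c z) (fromℕ< y<z)
    absent : inImage (c y) col ≡ 0F
    absent = inImage-no (c y) col (proper y<z)
    agree : inImage (c y) col ≡ inImage (c z) col
    agree = funToFin-injective sameImage col

halving : ∀ h → 2 ≤ h → Σ[ n ∈ ℕ ] n ≤ h × 2 + h ≤ n + n × n + n ≤ 3 + h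
halving 0 ()
halving 1 (s≤s ())
halving 2 _ = 2 , ≤-refl , ≤-refl , n≤1+n 4
halving 3 _ = 3 , ≤-refl , n≤1+n 5 , ≤-refl
halving (suc (suc (suc (suc h)))) _
  with n , n≤h , 2+h≤n+n , n+n≤3+h ← halving (suc (suc h)) (s≤s (s≤s z≤n)) =
  suc n ,
  ≤-trans (s≤s n≤h) (n≤1+n _) ,
  ≤-trans (s≤s (s≤s 2+h≤n+n)) (≤-reflexive (cong suc (sym (+-suc n n)))) ,
  ≤-trans (≤-reflexive (cong suc (+-suc n n))) (s≤s (s≤s n+n≤3+h))

module PairVertices (g n : ℕ) (n≤h : n ≤ 2 + g) (n+n≤3+h : n + n ≤ 3 + (2 + g)) where

  h : ℕ
  h = 2 + g

  pairVertex : ∀ {X Y} → X < Y → Y ≤ n → Vertex (h + h)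
  pairVertex {X} {Y} X<Y Y≤n = vtx (X + Y + g) ((X + h) ∸ Y) index≤2h depth≤index
    where
      open ≤-Reasoning
      1≤Y : 1 ≤ Y
      1≤Y = ≤-trans (s≤s z≤n) X<Y
      index≤2h : X + Y + g ≤ h + h
      index≤2h = s≤s⁻¹ (begin
        suc X + Y + g  ≤⟨ +-monoˡ-≤ g (+-mono-≤ (≤-trans X<Y Y≤n) Y≤n) ⟩
        n + n + g      ≤⟨ +-monoˡ-≤ g n+n≤3+h ⟩
        3 + h + g      ≡⟨ lemma g ⟩
        suc (h + h)    ∎)
        where
          lemma : ∀ g → 3 + (2 + g) + g ≡ suc ((2 + g) + (2 + g))
          lemma = solve-∀
      depth≤index : (X + h) ∸ Y ≤ X + Y + g
      depth≤index = m≤n+o⇒m∸n≤o (X + h) Y (begin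
        X + h             ≡⟨ lemma X g ⟩
        1 + (X + 1 + g)   ≤⟨ +-mono-≤ 1≤Y (+-monoˡ-≤ g (+-monoʳ-≤ X 1≤Y)) ⟩
        Y + (X + Y + g)   ∎)
        where
          lemma : ∀ X g → X + (2 + g) ≡ 1 + (X + 1 + g)
          lemma = solve-∀

  pairVertex-depth : ∀ {X Y} (X<Y : X < Y) (Y≤n : Y ≤ n) → j (pairVertex X<Y Y≤n) + Y ≡ X + h
  pairVertex-depth {X} _ Y≤n = m∸n+n≡m (≤-trans Y≤n (≤-trans n≤h (m≤n+m h X)))

  consecutivePairs-distEq : ∀ {X Y Y′ Z} (X<Y : X < Y) (Y≤n : Y ≤ n) (Y′<Z : Y′ < Z) (Z≤n : Z ≤ n) →
                            Y ≡ Y′ → DistEq (pairVertex X<Y Y≤n) (pairVertex Y′<Z Z≤n) (h + h)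
  consecutivePairs-distEq {X} {Y} X<Y Y≤n Y<Z Z≤n refl
    with e , refl ← m≤n⇒∃[o]m+o≡n (<-trans X<Y Y<Z) =
    distEq-across e (pairVertex X<Y Y≤n) (pairVertex Y<Z Z≤n) (gap X Y e g)
      (legs (pairVertex-depth X<Y Y≤n) (pairVertex-depth Y<Z Z≤n))
    where
      gap : ∀ X Y e g → suc e + (X + Y + g) ≡ Y + (suc X + e) + g
      gap = solve-∀
      legs : ∀ {A B} → A + Y ≡ X + h → B + (suc X + e) ≡ Y + h → A + suc e + B ≡ h + h
      legs {A} {B} A+Y≡X+h B+Z≡Y+h = +-cancelʳ-≡ (Y + X) _ _ (begin
        A + suc e + B + (Y + X)        ≡⟨ shuffle A B X Y e ⟩
        (A + Y) + (B + (suc X + e))    ≡⟨ cong₂ _+_ A+Y≡X+h B+Z≡Y+h ⟩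
        (X + h) + (Y + h)              ≡⟨ unshuffle X Y h ⟩
        h + h + (Y + X)                ∎)
        where
          open ≡-Reasoning
          shuffle : ∀ A B X Y e → A + suc e + B + (Y + X) ≡ (A + Y) + (B + (suc X + e))
          shuffle = solve-∀
          unshuffle : ∀ X Y h → (X + h) + (Y + h) ≡ h + h + (Y + X)
          unshuffle = solve-∀

  pairColouring : ∀ {k} → (Vertex (h + h) → Fin k) → (y : Fin (suc n)) → Fin′ y → Fin k
  pairColouring c y x = c (pairVertex (toℕ<n x) (toℕ≤pred[n] y))

  pairColouring-isShift : ∀ {k} {c : Vertex (h + h) → Fin k} → IsDistColoring (h + h) k c →
                          IsShiftColouring n k (pairColouring c)
  pairColouring-isShift proper {y} {z} y<z x = proper _ _
    (consecutivePairs-distEq (toℕ<n x) (toℕ≤pred[n] y) (toℕ<n (fromℕ< y<z)) (toℕ≤pred[n] z)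
      (sym (toℕ-fromℕ< y<z)))

2+h≤n+n⇒h+h+8≤2^[k+2] : ∀ {h n} k → 2 + h ≤ n + n → suc n ≤ 2 ^ k → h + h + 8 ≤ 2 ^ (k + 2)
2+h≤n+n⇒h+h+8≤2^[k+2] {h} {n} k 2+h≤n+n 1+n≤2^k = begin
  h + h + 8                  ≡⟨ lemma₁ h ⟩
  (2 + h) + (2 + h) + 4      ≤⟨ +-monoˡ-≤ 4 (+-mono-≤ 2+h≤n+n 2+h≤n+n) ⟩
  (n + n) + (n + n) + 4      ≡⟨ lemma₂ n ⟩
  suc n * 4                  ≤⟨ *-monoˡ-≤ 4 1+n≤2^k ⟩
  2 ^ k * 2 ^ 2              ≡⟨ ^-distribˡ-+-* 2 k 2 ⟨
  2 ^ (k + 2)                ∎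
  where
    open ≤-Reasoning
    lemma₁ : ∀ h → h + h + 8 ≡ (2 + h) + (2 + h) + 4
    lemma₁ = solve-∀
    lemma₂ : ∀ n → (n + n) + (n + n) + 4 ≡ suc n * 4
    lemma₂ = solve-∀

even⇒≡h+h : ∀ {d} → 2 ∣ d → ∃[ h ] d ≡ h + h
even⇒≡h+h (divides h refl) = h , trans (*-comm h 2) (cong (h +_) (+-identityʳ h))

≢⇒2≤n : ∀ {n} {a b : Fin n} → a ≢ b → 2 ≤ n
≢⇒2≤n {suc zero}    {0F} {0F} a≢b = contradiction refl a≢b
≢⇒2≤n {suc (suc n)}           _   = s≤s (s≤s z≤n)

-- For d = 2 the pairs do not fit into the tree, but the ends of the spine already need two colours.
diameterTwo-bound : ∀ k (c : Vertex 2 → Fin k) → IsDistColoring 2 k c → 2 + 8 ≤ 2 ^ (k + 2)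
diameterTwo-bound k c proper =
  ≤-trans (m≤m+n 10 6) (^-monoʳ-≤ 2 (+-monoˡ-≤ 2 (≢⇒2≤n (proper v₀ v₂ (distEq-across 1 v₀ v₂ refl refl)))))
  where
    v₀ v₂ : Vertex 2
    v₀ = vtx 0 0 z≤n z≤n
    v₂ = vtx 2 0 ≤-refl z≤n

mainTheorem3 : (d : ℕ) → 0 < d → 2 ∣ d →
    (k : ℕ) (c : Vertex d → Fin k) → IsDistColoring d k c →
    d + 8 ≤ 2 ^ (k + 2)
mainTheorem3 d 0<d 2∣d k c proper with even⇒≡h+h 2∣d
... | zero        , refl = contradiction 0<d (<-irrefl refl)
... | suc zero    , refl = diameterTwo-bound k c proper
... | suc (suc g) , refl with halving (2 + g) (s≤s (s≤s z≤n))
... | n , n≤h , 2+h≤n+n , n+n≤3+h =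
  2+h≤n+n⇒h+h+8≤2^[k+2] k 2+h≤n+n
    (shiftColouring⇒1+n≤2^k (pairColouring c) (pairColouring-isShift proper))
  where open PairVertices g n n≤h n+n≤3+h
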